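{- Let $n,R,m$ be positive integers, $\mathcal{U}=(u_{klr}),\mathcal{V}=(v_{klr}),\mathcal{W}=(w_{ijr})\in\mathbb{R}^{n\times n\times R}$, $\kappa=\frac{1}{n^3}\sum_{(i,j,l)\in[n]^3}(1-\sum_{r=1}^R u_{ilr}v_{ljr}w_{ijr})$, and suppose $1-\kappa>0$ and $(4n+m+R-2)\varepsilon_{\mathrm{machine}}\le 0.01$. Let $\hat f(\mathbf{A},\mathbf{B})$, for $\mathbf{A},\mathbf{B}\in\mathbb{R}^{mn\times mn}$ with floating point entries, be the randomized block bilinear computation described in the context, evaluated in floating point arithmetic. Then for every realization of the randomness, $$\|\mathrm{fl}(\hat f(\mathbf{A},\mathbf{B}))-\hat f(\mathbf{A},\mathbf{B})\|\le 1.01(4n+m+R-2)\sqrt{R}\,\varepsilon_{\mathrm{machine}}(1-\kappa)^{ -1}\|\mathbf{A}\|\|\mathbf{B}\|\sqrt{\sum_{r=1}^R\|\mathbf{U}_{::r}\|^2\|\mathbf{V}_{::r}\|^2\|\mathbf{W}_{::r}\|^2}.$$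
   Context: $[n]=\{1,\dots,n\}$; $\|\cdot\|$ is the Frobenius norm; $\mathbf{U}_{::r}$ is the $r$-th frontal slice of $\mathcal{U}$ (entries $u_{klr}$), similarly $\mathbf{V}_{::r},\mathbf{W}_{::r}$. Matrices in $\mathbb{R}^{mn\times mn}$ are partitioned into $n\times n$ arrays of $m\times m$ blocks. Randomness: i.i.d. Rademacher $s_i(j)$, $(i,j)\in[3]\times[n]$; independent random permutations $\pi_1,\pi_2,\pi_3$ of $[n]$ with $\mathbb{P}[\pi_i(j)=k]=1/n$. The randomized computation is $$\hat f(\mathbf{A},\mathbf{B})_{ij}=\sum_{r=1}^R\hat w_{ijr}\Big(\sum_{k,l=1}^n\hat u_{klr}\mathbf{A}_{kl}\Big)\Big(\sum_{k',l'=1}^n\hat v_{k'l'r}\mathbf{B}_{k'l'}\Big),$$ with $\hat u_{klr}=u_{\pi_1(k)\pi_2(l)r}s_1(k)s_2(l)$, $\hat v_{k'l'r}=v_{\pi_2(k')\pi_3(l')r}s_2(k')s_3(l')$, $\hat w_{ijr}=(1-\kappa)^{ -1}s_1(i)s_3(j)w_{\pi_1(i)\pi_3(j)r}$ (in exact arithmetic this equals $(1-\kappa)^{ -1}\mathbf{M}_1^\top f(\mathbf{M}_1\mathbf{A}\mathbf{M}_2^\top,\mathbf{M}_2\mathbf{B}\mathbf{M}_3^\top)\mathbf{M}_3$ with $\mathbf{M}_i$ signed block permutation matrices). The entries of $\mathbf{A},\mathbf{B}$ and of the coefficient tensors $\hat u,\hat v,\hat w$ are assumed to be floating point numbers. Floating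 point model: $\mathrm{fl}(x\,\mathrm{op}\,y)=(x\,\mathrm{op}\,y)(1+\Delta)$, $|\Delta|\le\varepsilon_{\mathrm{machine}}$; sums evaluated sequentially; the linear combinations of blocks are computed entrywise (summing over $l$, then $k$), block products by the standard algorithm with sequential inner products, then multiplication by $\hat w_{ijr}$, then sequential summation over $r$.
   Formalization: The coefficient tensors $\mathcal{U}$, $\mathcal{V}$, $\mathcal{W}$, the machine precision $\varepsilon_{\mathrm{machine}}$ and the relative errors $\Delta$ of the floating point model take rational values rather than real ones. -}

module Defs where

open import Data.Nat as ℕ using (ℕ; zero; suc; NonZero; _^_)
open import Data.Nat.Properties using (m^n≢0)
open import Data.Integer using (+_)
open import Data.Fin using (Fin; zero; suc)
open import Data.Fin.Permutation using (Permutation′; _⟨$⟩ʳ_)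
open import Data.Sign using (Sign)
open import Data.Rational using (ℚ; 0ℚ; 1ℚ; _+_; _*_; _-_; -_; _/_; 1/_; _<_; >-nonZero)
open import Function using (_∘_)

ℕtoℚ : ℕ → ℚ
ℕtoℚ k = + k / 1

signℚ : Sign → ℚ
signℚ Sign.+ = 1ℚ
signℚ Sign.- = - 1ℚ

Σ : ∀ {k} → (Fin k → ℚ) → ℚ
Σ {zero}  x = 0ℚ
Σ {suc k} x = x zero + Σ (x ∘ suc)

inv : (x : ℚ) → 0ℚ < x → ℚ
inv x p = 1/_ x {{>-nonZero p}}

-- Floating point sequential summation in the standard model.
-- flsum δ x computes (((x₀ + x₁)(1+δ₁) + x₂)(1+δ₂) + …); δ₀ is unused.

flfold : ∀ {k} → ℚ → (Fin k → ℚ) → (Fin k → ℚ) → ℚ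
flfold {zero}  acc δ x = acc
flfold {suc k} acc δ x = flfold ((acc + x zero) * (1ℚ + δ zero)) (δ ∘ suc) (x ∘ suc)

flsum : ∀ {k} → (Fin k → ℚ) → (Fin k → ℚ) → ℚ
flsum {zero}  δ x = 0ℚ
flsum {suc k} δ x = flfold (x zero) (δ ∘ suc) (x ∘ suc)

Tensor : ℕ → ℕ → Set
Tensor n R = Fin n → Fin n → Fin R → ℚ

-- an mn×mn matrix partitioned into n×n blocks of size m×m:
-- M k l p q is entry (p,q) of block (k,l)
BlockMat : ℕ → ℕ → Set
BlockMat n m = Fin n → Fin n → Fin m → Fin m → ℚ

frobSq : ∀ {n m} → BlockMat n m → ℚ
frobSq M = Σ λ k → Σ λ l → Σ λ p → Σ λ q → M k l p q * M k l p q

sliceSq : ∀ {n R} → Tensor n R → Fin R → ℚ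
sliceSq T r = Σ λ k → Σ λ l → T k l r * T k l r

kappa : ∀ {R} (n : ℕ) .{{_ : NonZero n}} → Tensor n R → Tensor n R → Tensor n R → ℚ
kappa n U V W =
  _/_ (+ 1) (n ^ 3) {{m^n≢0 n 3}} *
  (Σ λ i → Σ λ j → Σ λ l → 1ℚ - Σ λ r → U i l r * V l j r * W i j r)

record Randomness (n : ℕ) : Set where
  field
    s₁ s₂ s₃ : Fin n → Sign
    π₁ π₂ π₃ : Permutation′ n

-- randomized coefficients û, v̂, ŵ ; c stands for (1-κ)⁻¹
module Hat {n R : ℕ} (ρ : Randomness n) (U V W : Tensor n R) (c : ℚ) where
  open Randomness ρ
  û : Tensor n R
  û k l r = U (π₁ ⟨$⟩ʳ k) (π₂ ⟨$⟩ʳ l) r * signℚ (s₁ k) * signℚ (s₂ l)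
  v̂ : Tensor n R
  v̂ k l r = V (π₂ ⟨$⟩ʳ k) (π₃ ⟨$⟩ʳ l) r * signℚ (s₂ k) * signℚ (s₃ l)
  ŵ : Tensor n R
  ŵ i j r = c * signℚ (s₁ i) * signℚ (s₃ j) * W (π₁ ⟨$⟩ʳ i) (π₃ ⟨$⟩ʳ j) r

exactEval : ∀ {n m R} → Tensor n R → Tensor n R → Tensor n R →
            BlockMat n m → BlockMat n m → BlockMat n m
exactEval û v̂ ŵ A B i j p q =
  Σ λ r → ŵ i j r *
    (Σ λ t → (Σ λ k → Σ λ l → û k l r * A k l p t) *
             (Σ λ k → Σ λ l → v̂ k l r * B k l t q))

-- Labels of the individual rounded floating point operations.

data Op (n m R : ℕ) : Set where
  -- linear combination Σ_k Σ_l û_klr A_kl, entry (p,q):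
  aMul : Fin R → Fin m → Fin m → Fin n → Fin n → Op n m R  -- product û_klr·(A_kl)_pq
  aIn  : Fin R → Fin m → Fin m → Fin n → Fin n → Op n m R  -- addition in the sum over l
  aOut : Fin R → Fin m → Fin m → Fin n → Op n m R          -- addition in the sum over k
  -- same for B
  bMul : Fin R → Fin m → Fin m → Fin n → Fin n → Op n m R
  bIn  : Fin R → Fin m → Fin m → Fin n → Fin n → Op n m R
  bOut : Fin R → Fin m → Fin m → Fin n → Op n m R
  -- block product (standard algorithm, sequential inner product over t), entry (p,q)
  pMul : Fin R → Fin m → Fin m → Fin m → Op n m R
  pAdd : Fin R → Fin m → Fin m → Fin m → Op n m R
  -- multiplication by ŵ_ijr, entry (p,q) of output block (i,j)
  wMul : Fin n → Fin n → Fin R → Fin m → Fin m → Op n m R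
  -- sequential summation over r
  rAdd : Fin n → Fin n → Fin m → Fin m → Fin R → Op n m R

flEval : ∀ {n m R} → (Op n m R → ℚ) → Tensor n R → Tensor n R → Tensor n R →
         BlockMat n m → BlockMat n m → BlockMat n m
flEval {n} {m} {R} δ û v̂ ŵ A B i j p q =
  flsum (λ r → δ (rAdd i j p q r))
        (λ r → (ŵ i j r * P r p q) * (1ℚ + δ (wMul i j r p q)))
  where
  SA : Fin R → Fin m → Fin m → ℚ
  SA r a b = flsum (λ k → δ (aOut r a b k)) λ k →
               flsum (λ l → δ (aIn r a b k l)) λ l →
                 (û k l r * A k l a b) * (1ℚ + δ (aMul r a b k l))
  SB : Fin R → Fin m → Fin m → ℚ
  SB r a b = flsum (λ k → δ (bOut r a b k)) λ k →
               flsum (λ l → δ (bIn r a b k l)) λ l →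
                 (v̂ k l r * B k l a b) * (1ℚ + δ (bMul r a b k l))
  P : Fin R → Fin m → Fin m → ℚ
  P r a b = flsum (λ t → δ (pAdd r a b t))
                  (λ t → (SA r a t * SB r t b) * (1ℚ + δ (pMul r a b t)))

_−ᴮ_ : ∀ {n m} → BlockMat n m → BlockMat n m → BlockMat n m
(X −ᴮ Y) k l p q = X k l p q - Y k l p q

-- Counting roundings multiplicatively (a product inherits the counts of both factors), an entry of
-- the result carries at most N = 4n + m + R - 2 of them: 2n - 1 from each of the two linear
-- combinations, one for their product, m - 1 in the inner sum of the block product, one for the
-- multiplication by ŵ and R - 1 in the sum over r. Hence each computed entry differs from the exact
-- one by at most γ_N = (1 + ε)^N - 1 ≤ 1.01 N ε times the same computation carried out on absolute
-- values. Squaring and summing, the error is at most γ_N² times the squared Frobenius norm of that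
-- absolute computation, which Cauchy-Schwarz (over r, over the inner index of each block product,
-- and over the blocks of each linear combination) bounds by R Σ_r ‖Û_r‖² ‖V̂_r‖² ‖Ŵ_r‖² ‖A‖² ‖B‖².
-- Signs and permutations leave the slice norms unchanged, and Ŵ carries the factor (1 - κ)⁻¹.

module Submission where

open import Defs
open import Data.Nat using (ℕ; NonZero; _∸_)
open import Data.Rational using (ℚ; 0ℚ; 1ℚ; _+_; _*_; _-_; _/_; _≤_; _<_; ∣_∣)
open import Data.Integer using (+_)

open import Algebra.Bundles using (CommutativeRing)
import Algebra.Properties.CommutativeMonoid.Sum as CommutativeMonoidSum
import Algebra.Properties.Semiring.Exp as SemiringExp
open import Data.Empty using (⊥-elim)
open import Data.Fin using (Fin; zero; suc)
open import Data.Fin.Permutation using (Permutation′; _⟨$⟩ʳ_)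
import Data.Integer as ℤ
import Data.Integer.Tactic.RingSolver as ℤ-Ring
import Data.Nat.Tactic.RingSolver as ℕ-Ring
import Data.Nat as ℕ
import Data.Nat.Properties as ℕₚ
open import Data.Rational using (-_; nonNegative; toℚᵘ)
import Data.Rational.Properties as ℚₚ
import Data.Rational.Unnormalised as ℚᵘ
import Data.Rational.Unnormalised.Properties as ℚᵘₚ
open import Data.Rational.Solver using (module +-*-Solver)
open import Data.Sign using (Sign)
open import Data.Sum using (inj₁; inj₂)
open import Function using (_∘_)
open import Relation.Binary.PropositionalEquality
open import Relation.Nullary using (yes; no)

open +-*-Solver using (solve; _:=_; _:+_; _:*_; _:-_; :-_; con)
open ℚₚ using (≤-refl; ≤-trans; ≤-reflexive; 0≤∣p∣)

*-mono-≤-nonNeg : ∀ {p q r s} → 0ℚ ≤ p → 0ℚ ≤ r → p ≤ q → r ≤ s → p * r ≤ q * s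
*-mono-≤-nonNeg {q = q} {r = r} 0≤p 0≤r p≤q r≤s = ≤-trans
  (ℚₚ.*-monoʳ-≤-nonNeg r {{nonNegative 0≤r}} p≤q)
  (ℚₚ.*-monoˡ-≤-nonNeg q {{nonNegative (≤-trans 0≤p p≤q)}} r≤s)

0≤p*q : ∀ {p q} → 0ℚ ≤ p → 0ℚ ≤ q → 0ℚ ≤ p * q
0≤p*q = *-mono-≤-nonNeg ≤-refl ≤-refl

p*p≡∣p∣*∣p∣ : ∀ p → p * p ≡ ∣ p ∣ * ∣ p ∣
p*p≡∣p∣*∣p∣ p with ℚₚ.∣p∣≡p∨∣p∣≡-p p
... | inj₁ ∣p∣≡p  rewrite ∣p∣≡p  = refl
... | inj₂ ∣p∣≡-p rewrite ∣p∣≡-p = solve 1 (λ p → p :* p := (:- p) :* (:- p)) refl p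

0≤p*p : ∀ p → 0ℚ ≤ p * p
0≤p*p p rewrite p*p≡∣p∣*∣p∣ p = 0≤p*q (0≤∣p∣ p) (0≤∣p∣ p)

0≤q-p⇒p≤q : ∀ {p q} → 0ℚ ≤ q - p → p ≤ q
0≤q-p⇒p≤q {p} {q} 0≤q-p = ≤-trans (≤-reflexive (sym (ℚₚ.+-identityʳ p)))
  (≤-trans (ℚₚ.+-monoʳ-≤ p 0≤q-p) (≤-reflexive (solve 2 (λ p q → p :+ (q :- p) := q) refl p q)))

p≤q⇒0≤q-p : ∀ {p q} → p ≤ q → 0ℚ ≤ q - p
p≤q⇒0≤q-p {p} p≤q = ≤-trans (≤-reflexive (sym (ℚₚ.+-inverseʳ p))) (ℚₚ.+-monoˡ-≤ (- p) p≤q)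

p*p≤q*q⇒p≤q : ∀ {p q} → 0ℚ ≤ q → p * p ≤ q * q → p ≤ q
p*p≤q*q⇒p≤q {p} {q} 0≤q p²≤q² with p ℚₚ.≤? q
... | yes p≤q = p≤q
... | no  p≰q = ⊥-elim (ℚₚ.<-irrefl refl (ℚₚ.≤-<-trans p²≤q² q²<p²))
  where
  q<p : q < p
  q<p = ℚₚ.≰⇒> p≰q
  q²<p² : q * q < p * p
  q²<p² = ℚₚ.≤-<-trans (ℚₚ.*-monoˡ-≤-nonNeg q {{nonNegative 0≤q}} (ℚₚ.<⇒≤ q<p))
            (ℚₚ.*-monoˡ-<-pos p {{Data.Rational.positive (ℚₚ.≤-<-trans 0≤q q<p)}} q<p)

ℕtoℚ-suc : ∀ k → ℕtoℚ (ℕ.suc k) ≡ 1ℚ + ℕtoℚ k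
ℕtoℚ-suc k = ℚₚ.toℚᵘ-injective (begin
  toℚᵘ (ℕtoℚ (ℕ.suc k))        ≈⟨ ℚₚ.toℚᵘ-fromℚᵘ (ℚᵘ.mkℚᵘ (+ ℕ.suc k) 0) ⟩
  ℚᵘ.mkℚᵘ (+ ℕ.suc k) 0        ≈⟨ ℚᵘ.*≡* (suc-as-sum (+ k)) ⟩
  ℚᵘ.1ℚᵘ ℚᵘ.+ ℚᵘ.mkℚᵘ (+ k) 0  ≈⟨ ℚᵘₚ.+-congʳ ℚᵘ.1ℚᵘ (ℚᵘₚ.≃-sym (ℚₚ.toℚᵘ-fromℚᵘ (ℚᵘ.mkℚᵘ (+ k) 0))) ⟩
  ℚᵘ.1ℚᵘ ℚᵘ.+ toℚᵘ (ℕtoℚ k)    ≈⟨ ℚᵘₚ.≃-sym (ℚₚ.toℚᵘ-homo-+ 1ℚ (ℕtoℚ k)) ⟩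
  toℚᵘ (1ℚ + ℕtoℚ k)           ∎)
  where
  open ℚᵘₚ.≃-Reasoning
  suc-as-sum : ∀ x → (+ 1 ℤ.+ x) ℤ.* (+ 1 ℤ.* + 1) ≡ (+ 1 ℤ.* + 1 ℤ.+ x ℤ.* + 1) ℤ.* + 1
  suc-as-sum = ℤ-Ring.solve-∀

0≤ℕtoℚ : ∀ k → 0ℚ ≤ ℕtoℚ k
0≤ℕtoℚ k = ℚₚ.nonNegative⁻¹ (ℕtoℚ k) {{ℚₚ.normalize-nonNeg k 1}}

Σ-cong : ∀ {k} {f g : Fin k → ℚ} → (∀ i → f i ≡ g i) → Σ f ≡ Σ g
Σ-cong {ℕ.zero}  f≡g = refl
Σ-cong {ℕ.suc k} f≡g = cong₂ _+_ (f≡g zero) (Σ-cong (f≡g ∘ suc))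

Σ-mono : ∀ {k} {f g : Fin k → ℚ} → (∀ i → f i ≤ g i) → Σ f ≤ Σ g
Σ-mono {ℕ.zero}  f≤g = ≤-refl
Σ-mono {ℕ.suc k} f≤g = ℚₚ.+-mono-≤ (f≤g zero) (Σ-mono (f≤g ∘ suc))

0≤Σ : ∀ {k} {f : Fin k → ℚ} → (∀ i → 0ℚ ≤ f i) → 0ℚ ≤ Σ f
0≤Σ {ℕ.zero}  0≤f = ≤-refl
0≤Σ {ℕ.suc k} 0≤f = ℚₚ.+-mono-≤ (0≤f zero) (0≤Σ (0≤f ∘ suc))

Σ-zero : ∀ k → Σ {k} (λ _ → 0ℚ) ≡ 0ℚ
Σ-zero ℕ.zero    = refl
Σ-zero (ℕ.suc k) = cong (_+_ 0ℚ) (Σ-zero k)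

Σ-one : ∀ k → Σ {k} (λ _ → 1ℚ) ≡ ℕtoℚ k
Σ-one ℕ.zero    = refl
Σ-one (ℕ.suc k) = trans (cong (_+_ 1ℚ) (Σ-one k)) (sym (ℕtoℚ-suc k))

Σ-distrib-+ : ∀ {k} (f g : Fin k → ℚ) → Σ (λ i → f i + g i) ≡ Σ f + Σ g
Σ-distrib-+ {ℕ.zero}  f g = refl
Σ-distrib-+ {ℕ.suc k} f g = trans (cong (_+_ (f zero + g zero)) (Σ-distrib-+ (f ∘ suc) (g ∘ suc)))
  (solve 4 (λ a b c d → (a :+ b) :+ (c :+ d) := (a :+ c) :+ (b :+ d)) refl
     (f zero) (g zero) (Σ (f ∘ suc)) (Σ (g ∘ suc)))

Σ-*ˡ : ∀ {k} c (f : Fin k → ℚ) → Σ (λ i → c * f i) ≡ c * Σ f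
Σ-*ˡ {ℕ.zero}  c f = sym (ℚₚ.*-zeroʳ c)
Σ-*ˡ {ℕ.suc k} c f = trans (cong (_+_ (c * f zero)) (Σ-*ˡ c (f ∘ suc)))
  (sym (ℚₚ.*-distribˡ-+ c (f zero) (Σ (f ∘ suc))))

Σ-*ʳ : ∀ {k} c (f : Fin k → ℚ) → Σ (λ i → f i * c) ≡ Σ f * c
Σ-*ʳ c f = trans (Σ-cong λ i → ℚₚ.*-comm (f i) c) (trans (Σ-*ˡ c f) (ℚₚ.*-comm c (Σ f)))

Σ-*-Σ : ∀ {a b} (f : Fin a → ℚ) (g : Fin b → ℚ) → Σ (λ i → Σ λ j → f i * g j) ≡ Σ f * Σ g
Σ-*-Σ f g = trans (Σ-cong λ i → Σ-*ˡ (f i) g) (Σ-*ʳ (Σ g) f)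

Σ-comm : ∀ {a b} (F : Fin a → Fin b → ℚ) → Σ (λ i → Σ λ j → F i j) ≡ Σ (λ j → Σ λ i → F i j)
Σ-comm {ℕ.zero}  {b} F = sym (Σ-zero b)
Σ-comm {ℕ.suc a} {b} F = trans (cong (_+_ (Σ (F zero))) (Σ-comm (F ∘ suc)))
  (sym (Σ-distrib-+ (F zero) (λ j → Σ λ i → F (suc i) j)))

Σ-permute : ∀ {k} (π : Permutation′ k) (f : Fin k → ℚ) → Σ (λ i → f (π ⟨$⟩ʳ i)) ≡ Σ f
Σ-permute π f = trans (Σ≡sum (f ∘ (π ⟨$⟩ʳ_))) (trans (sym (sum-permute f π)) (sym (Σ≡sum f)))
  where
  open CommutativeMonoidSum ℚₚ.+-0-commutativeMonoid using (sum; sum-permute)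
  Σ≡sum : ∀ {k} (f : Fin k → ℚ) → Σ f ≡ sum f
  Σ≡sum {ℕ.zero}  f = refl
  Σ≡sum {ℕ.suc k} f = cong (_+_ (f zero)) (Σ≡sum (f ∘ suc))

Σ₂ : ∀ {a b} → (Fin a → Fin b → ℚ) → ℚ
Σ₂ F = Σ λ i → Σ (F i)

Σ₂-cong : ∀ {a b} {F G : Fin a → Fin b → ℚ} → (∀ i j → F i j ≡ G i j) → Σ₂ F ≡ Σ₂ G
Σ₂-cong F≡G = Σ-cong λ i → Σ-cong (F≡G i)

Σ₂-mono : ∀ {a b} {F G : Fin a → Fin b → ℚ} → (∀ i j → F i j ≤ G i j) → Σ₂ F ≤ Σ₂ G
Σ₂-mono F≤G = Σ-mono λ i → Σ-mono (F≤G i)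

0≤Σ₂ : ∀ {a b} {F : Fin a → Fin b → ℚ} → (∀ i j → 0ℚ ≤ F i j) → 0ℚ ≤ Σ₂ F
0≤Σ₂ 0≤F = 0≤Σ λ i → 0≤Σ (0≤F i)

Σ₂-*ˡ : ∀ {a b} c (F : Fin a → Fin b → ℚ) → Σ₂ (λ i j → c * F i j) ≡ c * Σ₂ F
Σ₂-*ˡ c F = trans (Σ-cong λ i → Σ-*ˡ c (F i)) (Σ-*ˡ c (λ i → Σ (F i)))

Σ₂-*ʳ : ∀ {a b} c (F : Fin a → Fin b → ℚ) → Σ₂ (λ i j → F i j * c) ≡ Σ₂ F * c
Σ₂-*ʳ c F = trans (Σ-cong λ i → Σ-*ʳ c (F i)) (Σ-*ʳ c (λ i → Σ (F i)))

Σ₂-*-Σ₂ : ∀ {a b c d} (F : Fin a → Fin b → ℚ) (G : Fin c → Fin d → ℚ) →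
          Σ₂ (λ i j → Σ₂ λ k l → F i j * G k l) ≡ Σ₂ F * Σ₂ G
Σ₂-*-Σ₂ F G = trans (Σ₂-cong λ i j → Σ₂-*ˡ (F i j) G) (Σ₂-*ʳ (Σ₂ G) F)

Σ₂-Σ-comm : ∀ {a b c} (F : Fin a → Fin b → Fin c → ℚ) →
            Σ₂ (λ i j → Σ (F i j)) ≡ Σ (λ r → Σ₂ λ i j → F i j r)
Σ₂-Σ-comm F = trans (Σ-cong λ i → Σ-comm (F i)) (Σ-comm λ i r → Σ λ j → F i j r)

Σ₂-Σ₂-comm : ∀ {a b c d} (F : Fin a → Fin b → Fin c → Fin d → ℚ) →
             Σ₂ (λ i j → Σ₂ (F i j)) ≡ Σ₂ (λ k l → Σ₂ λ i j → F i j k l)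
Σ₂-Σ₂-comm F = trans (Σ₂-Σ-comm λ i j k → Σ (F i j k)) (Σ-cong λ k → Σ₂-Σ-comm λ i j → F i j k)

Σ₂-permute : ∀ {a b} (π : Permutation′ a) (σ : Permutation′ b) (F : Fin a → Fin b → ℚ) →
             Σ₂ (λ i j → F (π ⟨$⟩ʳ i) (σ ⟨$⟩ʳ j)) ≡ Σ₂ F
Σ₂-permute π σ F = trans (Σ-cong λ i → Σ-permute σ (F (π ⟨$⟩ʳ i))) (Σ-permute π (Σ ∘ F))

cross-term-≤ : ∀ {x y X Y s S} → 0ℚ ≤ x → 0ℚ ≤ y → 0ℚ ≤ X → 0ℚ ≤ Y →
               s * s ≤ x * y → S * S ≤ X * Y → s * S + s * S ≤ x * Y + X * y
cross-term-≤ {x} {y} {X} {Y} {s} {S} 0≤x 0≤y 0≤X 0≤Y s²≤xy S²≤XY =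
  p*p≤q*q⇒p≤q (ℚₚ.+-mono-≤ (0≤p*q 0≤x 0≤Y) (0≤p*q 0≤X 0≤y)) (begin
    (s * S + s * S) * (s * S + s * S)
      ≡⟨ solve 2 (λ s S → (s :* S :+ s :* S) :* (s :* S :+ s :* S) := con four :* ((s :* s) :* (S :* S)))
           refl s S ⟩
    four * ((s * s) * (S * S))
      ≤⟨ ℚₚ.*-monoˡ-≤-nonNeg four (*-mono-≤-nonNeg (0≤p*p s) (0≤p*p S) s²≤xy S²≤XY) ⟩
    four * ((x * y) * (X * Y))
      ≤⟨ 0≤q-p⇒p≤q (≤-trans (0≤p*p (x * Y - X * y)) (≤-reflexive am-gm)) ⟩
    (x * Y + X * y) * (x * Y + X * y) ∎)
  where
  open ℚₚ.≤-Reasoning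
  four : ℚ
  four = 1ℚ + 1ℚ + 1ℚ + 1ℚ
  am-gm : (x * Y - X * y) * (x * Y - X * y)
        ≡ (x * Y + X * y) * (x * Y + X * y) - four * ((x * y) * (X * Y))
  am-gm = solve 4 (λ x y X Y → (x :* Y :- X :* y) :* (x :* Y :- X :* y)
                               := (x :* Y :+ X :* y) :* (x :* Y :+ X :* y) :- con four :* ((x :* y) :* (X :* Y)))
            refl x y X Y

Σ-cauchy-schwarz : ∀ {k} (X Y S : Fin k → ℚ) → (∀ i → 0ℚ ≤ X i) → (∀ i → 0ℚ ≤ Y i) →
                   (∀ i → S i * S i ≤ X i * Y i) → Σ S * Σ S ≤ Σ X * Σ Y
Σ-cauchy-schwarz {ℕ.zero}  X Y S 0≤X 0≤Y S²≤XY = ≤-refl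
Σ-cauchy-schwarz {ℕ.suc k} X Y S 0≤X 0≤Y S²≤XY = begin
  (s + S′) * (s + S′)
    ≡⟨ solve 2 (λ s S → (s :+ S) :* (s :+ S) := s :* s :+ (s :* S :+ s :* S) :+ S :* S) refl s S′ ⟩
  s * s + (s * S′ + s * S′) + S′ * S′
    ≤⟨ ℚₚ.+-mono-≤ (ℚₚ.+-mono-≤ (S²≤XY zero) cross) tail ⟩
  x * y + (x * Y′ + X′ * y) + X′ * Y′
    ≡⟨ solve 4 (λ x y X Y → x :* y :+ (x :* Y :+ X :* y) :+ X :* Y := (x :+ X) :* (y :+ Y)) refl x y X′ Y′ ⟩
  (x + X′) * (y + Y′) ∎
  where
  open ℚₚ.≤-Reasoning
  x y s X′ Y′ S′ : ℚ
  x = X zero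
  y = Y zero
  s = S zero
  X′ = Σ (X ∘ suc)
  Y′ = Σ (Y ∘ suc)
  S′ = Σ (S ∘ suc)
  tail : S′ * S′ ≤ X′ * Y′
  tail = Σ-cauchy-schwarz (X ∘ suc) (Y ∘ suc) (S ∘ suc) (0≤X ∘ suc) (0≤Y ∘ suc) (S²≤XY ∘ suc)
  cross : s * S′ + s * S′ ≤ x * Y′ + X′ * y
  cross = cross-term-≤ {s = s} {S = S′} (0≤X zero) (0≤Y zero) (0≤Σ (0≤X ∘ suc)) (0≤Σ (0≤Y ∘ suc)) (S²≤XY zero) tail

square-* : ∀ p q → (p * q) * (p * q) ≡ (p * p) * (q * q)
square-* = solve 2 (λ p q → (p :* q) :* (p :* q) := (p :* p) :* (q :* q)) refl

Σ-cauchy-schwarz-* : ∀ {k} (f g : Fin k → ℚ) →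
                     Σ (λ i → f i * g i) * Σ (λ i → f i * g i) ≤ Σ (λ i → f i * f i) * Σ (λ i → g i * g i)
Σ-cauchy-schwarz-* f g = Σ-cauchy-schwarz _ _ _ (λ i → 0≤p*p (f i)) (λ i → 0≤p*p (g i))
  (λ i → ≤-reflexive (square-* (f i) (g i)))

Σ₂-cauchy-schwarz-* : ∀ {a b} (F G : Fin a → Fin b → ℚ) →
                      Σ₂ (λ i j → F i j * G i j) * Σ₂ (λ i j → F i j * G i j)
                        ≤ Σ₂ (λ i j → F i j * F i j) * Σ₂ (λ i j → G i j * G i j)
Σ₂-cauchy-schwarz-* F G = Σ-cauchy-schwarz _ _ _ (λ i → 0≤Σ λ j → 0≤p*p (F i j)) (λ i → 0≤Σ λ j → 0≤p*p (G i j))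
  (λ i → Σ-cauchy-schwarz-* (F i) (G i))

Σ-square-≤ : ∀ {k} (f : Fin k → ℚ) → Σ f * Σ f ≤ ℕtoℚ k * Σ (λ i → f i * f i)
Σ-square-≤ {k} f = begin
  Σ f * Σ f
    ≤⟨ Σ-cauchy-schwarz (λ _ → 1ℚ) (λ i → f i * f i) f (λ _ → ℚₚ.nonNegative⁻¹ 1ℚ) (λ i → 0≤p*p (f i))
         (λ i → ≤-reflexive (sym (ℚₚ.*-identityˡ (f i * f i)))) ⟩
  Σ {k} (λ _ → 1ℚ) * Σ (λ i → f i * f i)
    ≡⟨ cong (_* Σ (λ i → f i * f i)) (Σ-one k) ⟩
  ℕtoℚ k * Σ (λ i → f i * f i) ∎
  where open ℚₚ.≤-Reasoning

Matrix : ℕ → ℕ → Set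
Matrix a b = Fin a → Fin b → ℚ

sqNorm : ∀ {a b} → Matrix a b → ℚ
sqNorm M = Σ₂ λ i j → M i j * M i j

0≤sqNorm : ∀ {a b} (M : Matrix a b) → 0ℚ ≤ sqNorm M
0≤sqNorm M = 0≤Σ₂ λ i j → 0≤p*p (M i j)

0≤frobSq : ∀ {n m} (M : BlockMat n m) → 0ℚ ≤ frobSq M
0≤frobSq M = 0≤Σ₂ λ k l → 0≤sqNorm (M k l)

sqNorm-∣∣ : ∀ {a b} (M : Matrix a b) → sqNorm (λ i j → ∣ M i j ∣) ≡ sqNorm M
sqNorm-∣∣ M = Σ₂-cong λ i j → sym (p*p≡∣p∣*∣p∣ (M i j))

infixl 7 _·_
_·_ : ∀ {a b c} → Matrix a b → Matrix b c → Matrix a c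
(M · N) i j = Σ λ t → M i t * N t j

sqNorm-·-≤ : ∀ {a b c} (M : Matrix a b) (N : Matrix b c) → sqNorm (M · N) ≤ sqNorm M * sqNorm N
sqNorm-·-≤ M N = begin
  sqNorm (M · N)
    ≤⟨ Σ₂-mono (λ i j → Σ-cauchy-schwarz-* (M i) (λ t → N t j)) ⟩
  Σ₂ (λ i j → Σ (λ t → M i t * M i t) * Σ (λ t → N t j * N t j))
    ≡⟨ Σ-*-Σ (λ i → Σ λ t → M i t * M i t) (λ j → Σ λ t → N t j * N t j) ⟩
  sqNorm M * Σ (λ j → Σ λ t → N t j * N t j)
    ≡⟨ cong (sqNorm M *_) (Σ-comm λ j t → N t j * N t j) ⟩
  sqNorm M * sqNorm N ∎
  where open ℚₚ.≤-Reasoning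

linComb : ∀ {n m R} → Tensor n R → BlockMat n m → Fin R → Matrix m m
linComb T M r p q = Σ₂ λ k l → T k l r * M k l p q

sqNorm-linComb-≤ : ∀ {n m R} (T : Tensor n R) (M : BlockMat n m) r →
                   sqNorm (linComb T M r) ≤ sliceSq T r * frobSq M
sqNorm-linComb-≤ T M r = begin
  sqNorm (linComb T M r)
    ≤⟨ Σ₂-mono (λ p q → Σ₂-cauchy-schwarz-* (λ k l → T k l r) (λ k l → M k l p q)) ⟩
  Σ₂ (λ p q → sliceSq T r * Σ₂ λ k l → M k l p q * M k l p q)
    ≡⟨ Σ₂-*ˡ (sliceSq T r) (λ p q → Σ₂ λ k l → M k l p q * M k l p q) ⟩
  sliceSq T r * Σ₂ (λ p q → Σ₂ λ k l → M k l p q * M k l p q)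
    ≡⟨ cong (sliceSq T r *_) (Σ₂-Σ₂-comm λ p q k l → M k l p q * M k l p q) ⟩
  sliceSq T r * frobSq M ∎
  where open ℚₚ.≤-Reasoning

frobSq-Σ-≤ : ∀ {n m R} (w : Tensor n R) (X : Fin R → Matrix m m) →
             frobSq (λ i j p q → Σ λ r → w i j r * X r p q) ≤ ℕtoℚ R * Σ (λ r → sliceSq w r * sqNorm (X r))
frobSq-Σ-≤ {n} {m} {R} w X = begin
  frobSq (λ i j p q → Σ λ r → w i j r * X r p q)
    ≤⟨ Σ₂-mono (λ i j → Σ₂-mono λ p q → Σ-square-≤ λ r → w i j r * X r p q) ⟩
  Σ₂ (λ i j → Σ₂ λ p q → ℕtoℚ R * Σ λ r → wX² i j p q r)
    ≡⟨ trans (Σ₂-cong λ i j → Σ₂-*ˡ (ℕtoℚ R) (λ p q → Σ (wX² i j p q)))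
             (Σ₂-*ˡ (ℕtoℚ R) λ i j → Σ₂ λ p q → Σ (wX² i j p q)) ⟩
  ℕtoℚ R * Σ₂ (λ i j → Σ₂ λ p q → Σ λ r → wX² i j p q r)
    ≡⟨ cong (ℕtoℚ R *_) (trans (Σ₂-cong λ i j → Σ₂-Σ-comm (wX² i j))
                                (Σ₂-Σ-comm λ i j r → Σ₂ λ p q → wX² i j p q r)) ⟩
  ℕtoℚ R * Σ (λ r → Σ₂ λ i j → Σ₂ λ p q → wX² i j p q r)
    ≡⟨ cong (ℕtoℚ R *_) (Σ-cong λ r → trans (Σ₂-cong λ i j → Σ₂-cong λ p q → square-* (w i j r) (X r p q))
                                             (Σ₂-*-Σ₂ (λ i j → w i j r * w i j r) (λ p q → X r p q * X r p q))) ⟩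
  ℕtoℚ R * Σ (λ r → sliceSq w r * sqNorm (X r)) ∎
  where
  open ℚₚ.≤-Reasoning
  wX² : Fin n → Fin n → Fin m → Fin m → Fin R → ℚ
  wX² i j p q r = (w i j r * X r p q) * (w i j r * X r p q)

frobSq-exactEval-≤ : ∀ {n m R} (û v̂ ŵ : Tensor n R) (A B : BlockMat n m) →
  frobSq (exactEval û v̂ ŵ A B)
    ≤ ℕtoℚ R * Σ (λ r → sliceSq û r * sliceSq v̂ r * sliceSq ŵ r) * (frobSq A * frobSq B)
frobSq-exactEval-≤ {R = R} û v̂ ŵ A B = begin
  frobSq (exactEval û v̂ ŵ A B)
    ≤⟨ frobSq-Σ-≤ ŵ (λ r → linComb û A r · linComb v̂ B r) ⟩
  ℕtoℚ R * Σ (λ r → sliceSq ŵ r * sqNorm (linComb û A r · linComb v̂ B r))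
    ≤⟨ ℚₚ.*-monoˡ-≤-nonNeg (ℕtoℚ R) {{nonNegative (0≤ℕtoℚ R)}} (Σ-mono λ r →
         ℚₚ.*-monoˡ-≤-nonNeg (sliceSq ŵ r) {{nonNegative (0≤sqNorm λ k l → ŵ k l r)}} (product-≤ r)) ⟩
  ℕtoℚ R * Σ (λ r → sliceSq ŵ r * ((sliceSq û r * frobSq A) * (sliceSq v̂ r * frobSq B)))
    ≡⟨ cong (ℕtoℚ R *_) (trans (Σ-cong regroup)
                                (Σ-*ʳ (frobSq A * frobSq B) λ r → sliceSq û r * sliceSq v̂ r * sliceSq ŵ r)) ⟩
  ℕtoℚ R * (Σ (λ r → sliceSq û r * sliceSq v̂ r * sliceSq ŵ r) * (frobSq A * frobSq B))
    ≡⟨ sym (ℚₚ.*-assoc (ℕtoℚ R) _ _) ⟩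
  ℕtoℚ R * Σ (λ r → sliceSq û r * sliceSq v̂ r * sliceSq ŵ r) * (frobSq A * frobSq B) ∎
  where
  open ℚₚ.≤-Reasoning
  product-≤ : ∀ r → sqNorm (linComb û A r · linComb v̂ B r) ≤ (sliceSq û r * frobSq A) * (sliceSq v̂ r * frobSq B)
  product-≤ r = ≤-trans (sqNorm-·-≤ (linComb û A r) (linComb v̂ B r))
    (*-mono-≤-nonNeg (0≤sqNorm (linComb û A r)) (0≤sqNorm (linComb v̂ B r))
      (sqNorm-linComb-≤ û A r) (sqNorm-linComb-≤ v̂ B r))
  regroup : ∀ r → sliceSq ŵ r * ((sliceSq û r * frobSq A) * (sliceSq v̂ r * frobSq B))
                ≡ sliceSq û r * sliceSq v̂ r * sliceSq ŵ r * (frobSq A * frobSq B)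
  regroup r = solve 5 (λ w u a v b → w :* ((u :* a) :* (v :* b)) := u :* v :* w :* (a :* b)) refl
    (sliceSq ŵ r) (sliceSq û r) (frobSq A) (sliceSq v̂ r) (frobSq B)

∣_∣ᵀ : ∀ {n R} → Tensor n R → Tensor n R
∣ T ∣ᵀ k l r = ∣ T k l r ∣

∣_∣ᴮ : ∀ {n m} → BlockMat n m → BlockMat n m
∣ M ∣ᴮ k l p q = ∣ M k l p q ∣

frobSq-∣exactEval∣-≤ : ∀ {n m R} (û v̂ ŵ : Tensor n R) (A B : BlockMat n m) →
  frobSq (exactEval ∣ û ∣ᵀ ∣ v̂ ∣ᵀ ∣ ŵ ∣ᵀ ∣ A ∣ᴮ ∣ B ∣ᴮ)
    ≤ ℕtoℚ R * Σ (λ r → sliceSq û r * sliceSq v̂ r * sliceSq ŵ r) * (frobSq A * frobSq B)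
frobSq-∣exactEval∣-≤ {R = R} û v̂ ŵ A B =
  ≤-trans (frobSq-exactEval-≤ ∣ û ∣ᵀ ∣ v̂ ∣ᵀ ∣ ŵ ∣ᵀ ∣ A ∣ᴮ ∣ B ∣ᴮ) (≤-reflexive
    (cong₂ (λ S F → ℕtoℚ R * S * F)
      (Σ-cong λ r → cong₂ _*_ (cong₂ _*_ (sliceSq-∣∣ û r) (sliceSq-∣∣ v̂ r)) (sliceSq-∣∣ ŵ r))
      (cong₂ _*_ (frobSq-∣∣ A) (frobSq-∣∣ B))))
  where
  sliceSq-∣∣ : ∀ T r → sliceSq ∣ T ∣ᵀ r ≡ sliceSq T r
  sliceSq-∣∣ T r = sqNorm-∣∣ λ k l → T k l r
  frobSq-∣∣ : ∀ M → frobSq ∣ M ∣ᴮ ≡ frobSq M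
  frobSq-∣∣ M = Σ₂-cong λ k l → sqNorm-∣∣ (M k l)

frobSq-≤-entrywise : ∀ {n m} {X Y : BlockMat n m} g → (∀ i j p q → ∣ X i j p q ∣ ≤ g * Y i j p q) →
                     frobSq X ≤ (g * g) * frobSq Y
frobSq-≤-entrywise {X = X} {Y} g ∣X∣≤gY = begin
  frobSq X
    ≤⟨ Σ₂-mono (λ i j → Σ₂-mono λ p q → entry i j p q) ⟩
  Σ₂ (λ i j → Σ₂ λ p q → (g * g) * (Y i j p q * Y i j p q))
    ≡⟨ trans (Σ₂-cong λ i j → Σ₂-*ˡ (g * g) λ p q → Y i j p q * Y i j p q)
             (Σ₂-*ˡ (g * g) λ i j → sqNorm (Y i j)) ⟩
  (g * g) * frobSq Y ∎
  where
  open ℚₚ.≤-Reasoning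
  entry : ∀ i j p q → X i j p q * X i j p q ≤ (g * g) * (Y i j p q * Y i j p q)
  entry i j p q = begin
    X i j p q * X i j p q               ≡⟨ p*p≡∣p∣*∣p∣ (X i j p q) ⟩
    ∣ X i j p q ∣ * ∣ X i j p q ∣        ≤⟨ *-mono-≤-nonNeg (0≤∣p∣ _) (0≤∣p∣ _) (∣X∣≤gY i j p q)
                                                            (∣X∣≤gY i j p q) ⟩
    (g * Y i j p q) * (g * Y i j p q)   ≡⟨ square-* g (Y i j p q) ⟩
    (g * g) * (Y i j p q * Y i j p q)   ∎

module Rounding (ε : ℚ) (0≤ε : 0ℚ ≤ ε) where

  open SemiringExp (CommutativeRing.semiring ℚₚ.+-*-commutativeRing) using (_^_; ^-homo-*)

  γ : ℕ → ℚ
  γ k = (1ℚ + ε) ^ k - 1ℚ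

  1≤1+ε : 1ℚ ≤ 1ℚ + ε
  1≤1+ε = ≤-trans (≤-reflexive (sym (ℚₚ.+-identityʳ 1ℚ))) (ℚₚ.+-monoʳ-≤ 1ℚ 0≤ε)

  1≤[1+ε]^ : ∀ k → 1ℚ ≤ (1ℚ + ε) ^ k
  1≤[1+ε]^ ℕ.zero    = ≤-refl
  1≤[1+ε]^ (ℕ.suc k) = *-mono-≤-nonNeg (ℚₚ.nonNegative⁻¹ 1ℚ) (ℚₚ.nonNegative⁻¹ 1ℚ) 1≤1+ε (1≤[1+ε]^ k)

  [1+ε]^-mono : ∀ {j k} → j ℕ.≤ k → (1ℚ + ε) ^ j ≤ (1ℚ + ε) ^ k
  [1+ε]^-mono {k = k} ℕ.z≤n = 1≤[1+ε]^ k
  [1+ε]^-mono (ℕ.s≤s j≤k)   =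
    ℚₚ.*-monoˡ-≤-nonNeg (1ℚ + ε) {{nonNegative (≤-trans (ℚₚ.nonNegative⁻¹ 1ℚ) 1≤1+ε)}} ([1+ε]^-mono j≤k)

  0≤γ : ∀ k → 0ℚ ≤ γ k
  0≤γ k = p≤q⇒0≤q-p (1≤[1+ε]^ k)

  γ-mono : ∀ {j k} → j ℕ.≤ k → γ j ≤ γ k
  γ-mono j≤k = ℚₚ.+-monoˡ-≤ (- 1ℚ) ([1+ε]^-mono j≤k)

  -- x is the computed value of y after k roundings; the error is measured against a bound a
  -- on ∣ y ∣, namely the same expression evaluated on absolute values.
  record Approx (k : ℕ) (x y a : ℚ) : Set where
    field
      magnitude : ∣ y ∣ ≤ a
      error     : ∣ x - y ∣ ≤ γ k * a

  open Approx

  approx-cong : ∀ {k k′ x y y′ a a′} → k ≡ k′ → y ≡ y′ → a ≡ a′ → Approx k x y a → Approx k′ x y′ a′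
  approx-cong refl refl refl x≈y = x≈y

  approx-exact : ∀ k {y a} → ∣ y ∣ ≤ a → Approx k y y a
  approx-exact k {y} ∣y∣≤a .magnitude = ∣y∣≤a
  approx-exact k {y} ∣y∣≤a .error     = ≤-trans (≤-reflexive (cong ∣_∣ (ℚₚ.+-inverseʳ y)))
    (0≤p*q (0≤γ k) (≤-trans (0≤∣p∣ y) ∣y∣≤a))

  approx-weaken : ∀ {j k x y a} → j ℕ.≤ k → Approx j x y a → Approx k x y a
  approx-weaken {a = a} j≤k x≈y .magnitude = magnitude x≈y
  approx-weaken {a = a} j≤k x≈y .error     = ≤-trans (error x≈y)
    (ℚₚ.*-monoʳ-≤-nonNeg a {{nonNegative (≤-trans (0≤∣p∣ _) (magnitude x≈y))}} (γ-mono j≤k))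

  approx-+ : ∀ {k x₁ y₁ a₁ x₂ y₂ a₂} → Approx k x₁ y₁ a₁ → Approx k x₂ y₂ a₂ →
             Approx k (x₁ + x₂) (y₁ + y₂) (a₁ + a₂)
  approx-+ {k} {x₁} {y₁} {a₁} {x₂} {y₂} {a₂} h₁ h₂ = record
    { magnitude = ≤-trans (ℚₚ.∣p+q∣≤∣p∣+∣q∣ y₁ y₂) (ℚₚ.+-mono-≤ (magnitude h₁) (magnitude h₂))
    ; error     = begin
        ∣ x₁ + x₂ - (y₁ + y₂) ∣          ≡⟨ cong ∣_∣ (solve 4 (λ a b c d → a :+ b :- (c :+ d) := (a :- c) :+ (b :- d))
                                                    refl x₁ x₂ y₁ y₂) ⟩
        ∣ (x₁ - y₁) + (x₂ - y₂) ∣        ≤⟨ ℚₚ.∣p+q∣≤∣p∣+∣q∣ (x₁ - y₁) (x₂ - y₂) ⟩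
        ∣ x₁ - y₁ ∣ + ∣ x₂ - y₂ ∣        ≤⟨ ℚₚ.+-mono-≤ (error h₁) (error h₂) ⟩
        γ k * a₁ + γ k * a₂              ≡⟨ sym (ℚₚ.*-distribˡ-+ (γ k) a₁ a₂) ⟩
        γ k * (a₁ + a₂)                  ∎
    }
    where open ℚₚ.≤-Reasoning

  approx-* : ∀ {k₁ k₂ x₁ y₁ a₁ x₂ y₂ a₂} → Approx k₁ x₁ y₁ a₁ → Approx k₂ x₂ y₂ a₂ →
             Approx (k₁ ℕ.+ k₂) (x₁ * x₂) (y₁ * y₂) (a₁ * a₂)
  approx-* {k₁} {k₂} {x₁} {y₁} {a₁} {x₂} {y₂} {a₂} h₁ h₂ = record
    { magnitude = ≤-trans (≤-reflexive (ℚₚ.∣p*q∣≡∣p∣*∣q∣ y₁ y₂))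
                    (*-mono-≤-nonNeg (0≤∣p∣ y₁) (0≤∣p∣ y₂) (magnitude h₁) (magnitude h₂))
    ; error     = begin
        ∣ x₁ * x₂ - y₁ * y₂ ∣
          ≡⟨ cong ∣_∣ (solve 4 (λ a b c d → a :* b :- c :* d := a :* (b :- d) :+ (a :- c) :* d) refl x₁ x₂ y₁ y₂) ⟩
        ∣ x₁ * (x₂ - y₂) + (x₁ - y₁) * y₂ ∣
          ≤⟨ ℚₚ.∣p+q∣≤∣p∣+∣q∣ (x₁ * (x₂ - y₂)) ((x₁ - y₁) * y₂) ⟩
        ∣ x₁ * (x₂ - y₂) ∣ + ∣ (x₁ - y₁) * y₂ ∣
          ≡⟨ cong₂ _+_ (ℚₚ.∣p*q∣≡∣p∣*∣q∣ x₁ (x₂ - y₂)) (ℚₚ.∣p*q∣≡∣p∣*∣q∣ (x₁ - y₁) y₂) ⟩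
        ∣ x₁ ∣ * ∣ x₂ - y₂ ∣ + ∣ x₁ - y₁ ∣ * ∣ y₂ ∣
          ≤⟨ ℚₚ.+-mono-≤ (*-mono-≤-nonNeg (0≤∣p∣ x₁) (0≤∣p∣ (x₂ - y₂)) ∣x₁∣≤ (error h₂))
                          (*-mono-≤-nonNeg (0≤∣p∣ (x₁ - y₁)) (0≤∣p∣ y₂) (error h₁) (magnitude h₂)) ⟩
        (a₁ + γ k₁ * a₁) * (γ k₂ * a₂) + γ k₁ * a₁ * a₂
          ≡⟨ solve 4 (λ p q a b → (a :+ (p :- con 1ℚ) :* a) :* ((q :- con 1ℚ) :* b) :+ (p :- con 1ℚ) :* a :* b
                                  := (p :* q :- con 1ℚ) :* (a :* b)) refl ((1ℚ + ε) ^ k₁) ((1ℚ + ε) ^ k₂) a₁ a₂ ⟩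
        ((1ℚ + ε) ^ k₁ * (1ℚ + ε) ^ k₂ - 1ℚ) * (a₁ * a₂)
          ≡⟨ cong (λ P → (P - 1ℚ) * (a₁ * a₂)) (sym (^-homo-* (1ℚ + ε) k₁ k₂)) ⟩
        γ (k₁ ℕ.+ k₂) * (a₁ * a₂) ∎
    }
    where
    open ℚₚ.≤-Reasoning
    ∣x₁∣≤ : ∣ x₁ ∣ ≤ a₁ + γ k₁ * a₁
    ∣x₁∣≤ = ≤-trans (≤-reflexive (cong ∣_∣ (solve 2 (λ x y → x := y :+ (x :- y)) refl x₁ y₁)))
              (≤-trans (ℚₚ.∣p+q∣≤∣p∣+∣q∣ y₁ (x₁ - y₁)) (ℚₚ.+-mono-≤ (magnitude h₁) (error h₁)))

  approx-scale : ∀ {k x y a} c → Approx k x y a → Approx k (c * x) (c * y) (∣ c ∣ * a)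
  approx-scale c = approx-* (approx-exact 0 {c} ≤-refl)

  approx-round : ∀ {k x y a δ} → ∣ δ ∣ ≤ ε → Approx k x y a → Approx (ℕ.suc k) (x * (1ℚ + δ)) y a
  approx-round {k} {x} {y} {a} {δ} ∣δ∣≤ε x≈y =
    approx-cong (ℕₚ.+-comm k 1) (ℚₚ.*-identityʳ y) (ℚₚ.*-identityʳ a) (approx-* x≈y 1+δ≈1)
    where
    1+δ≈1 : Approx 1 (1ℚ + δ) 1ℚ 1ℚ
    1+δ≈1 = record
      { magnitude = ≤-refl
      ; error     = ≤-trans (≤-reflexive (cong ∣_∣ (solve 1 (λ d → con 1ℚ :+ d :- con 1ℚ := d) refl δ)))
                      (≤-trans ∣δ∣≤ε (≤-reflexive
                        (solve 1 (λ e → e := ((con 1ℚ :+ e) :* con 1ℚ :- con 1ℚ) :* con 1ℚ) refl ε)))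
      }

  [1+ε]^-≤ : ∀ k → ℕtoℚ k * ε ≤ 1ℚ → (1ℚ + ε) ^ k ≤ 1ℚ + ℕtoℚ k * ε + (ℕtoℚ k * ε) * (ℕtoℚ k * ε)
  [1+ε]^-≤ ℕ.zero    _ =
    ≤-reflexive (solve 1 (λ e → con 1ℚ := con 1ℚ :+ con 0ℚ :* e :+ (con 0ℚ :* e) :* (con 0ℚ :* e)) refl ε)
  [1+ε]^-≤ (ℕ.suc k) [k+1]ε≤1 = begin
    (1ℚ + ε) * (1ℚ + ε) ^ k
      ≤⟨ ℚₚ.*-monoˡ-≤-nonNeg (1ℚ + ε) {{nonNegative (≤-trans (ℚₚ.nonNegative⁻¹ 1ℚ) 1≤1+ε)}} ([1+ε]^-≤ k tε≤1) ⟩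
    (1ℚ + ε) * (1ℚ + t * ε + (t * ε) * (t * ε))
      ≤⟨ 0≤q-p⇒p≤q (≤-trans (0≤p*q (0≤p*p ε) slack) (≤-reflexive expand)) ⟩
    1ℚ + (1ℚ + t) * ε + ((1ℚ + t) * ε) * ((1ℚ + t) * ε)
      ≡⟨ cong (λ s → 1ℚ + s * ε + (s * ε) * (s * ε)) (sym (ℕtoℚ-suc k)) ⟩
    1ℚ + ℕtoℚ (ℕ.suc k) * ε + (ℕtoℚ (ℕ.suc k) * ε) * (ℕtoℚ (ℕ.suc k) * ε) ∎
    where
    open ℚₚ.≤-Reasoning
    t : ℚ
    t = ℕtoℚ k
    tε≤1 : t * ε ≤ 1ℚ
    tε≤1 = begin
      t * ε                      ≡⟨ sym (ℚₚ.+-identityˡ (t * ε)) ⟩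
      0ℚ + t * ε                 ≤⟨ ℚₚ.+-monoˡ-≤ (t * ε) 0≤ε ⟩
      ε + t * ε                  ≡⟨ solve 2 (λ t e → e :+ t :* e := (con 1ℚ :+ t) :* e) refl t ε ⟩
      (1ℚ + t) * ε               ≡⟨ cong (_* ε) (sym (ℕtoℚ-suc k)) ⟩
      ℕtoℚ (ℕ.suc k) * ε         ≤⟨ [k+1]ε≤1 ⟩
      1ℚ                         ∎
    slack : 0ℚ ≤ 1ℚ + t * (1ℚ - t * ε)
    slack = ℚₚ.+-mono-≤ (ℚₚ.nonNegative⁻¹ 1ℚ) (0≤p*q (0≤ℕtoℚ k) (p≤q⇒0≤q-p tε≤1))
    expand : (ε * ε) * (1ℚ + t * (1ℚ - t * ε))
           ≡ 1ℚ + (1ℚ + t) * ε + ((1ℚ + t) * ε) * ((1ℚ + t) * ε) - (1ℚ + ε) * (1ℚ + t * ε + (t * ε) * (t * ε))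
    expand = solve 2 (λ t e → (e :* e) :* (con 1ℚ :+ t :* (con 1ℚ :- t :* e))
      := con 1ℚ :+ (con 1ℚ :+ t) :* e :+ ((con 1ℚ :+ t) :* e) :* ((con 1ℚ :+ t) :* e)
         :- (con 1ℚ :+ e) :* (con 1ℚ :+ t :* e :+ (t :* e) :* (t :* e))) refl t ε

  γ-≤ : ∀ N → ℕtoℚ N * ε ≤ + 1 / 100 → γ N ≤ (+ 101 / 100 * ℕtoℚ N) * ε
  γ-≤ N Nε≤1/100 = begin
    (1ℚ + ε) ^ N - 1ℚ
      ≤⟨ ℚₚ.+-monoˡ-≤ (- 1ℚ) ([1+ε]^-≤ N (≤-trans Nε≤1/100 (ℚₚ.≤ᵇ⇒≤ _))) ⟩
    1ℚ + Nε + Nε * Nε - 1ℚ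
      ≡⟨ solve 1 (λ x → con 1ℚ :+ x :+ x :* x :- con 1ℚ := x :+ x :* x) refl Nε ⟩
    Nε + Nε * Nε
      ≤⟨ ℚₚ.+-monoʳ-≤ Nε (ℚₚ.*-monoˡ-≤-nonNeg Nε {{nonNegative (0≤p*q (0≤ℕtoℚ N) 0≤ε)}} Nε≤1/100) ⟩
    Nε + Nε * (+ 1 / 100)
      ≡⟨ solve 2 (λ n e → n :* e :+ n :* e :* con (+ 1 / 100) := (con (+ 101 / 100) :* n) :* e) refl (ℕtoℚ N) ε ⟩
    (+ 101 / 100 * ℕtoℚ N) * ε ∎
    where
    open ℚₚ.≤-Reasoning
    Nε : ℚ
    Nε = ℕtoℚ N * ε

  flfold-approx : ∀ {k} j K → K ℕ.≤ j → ∀ {acc accy acca} (δ x y a : Fin k → ℚ) →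
                  (∀ i → ∣ δ i ∣ ≤ ε) → Approx j acc accy acca → (∀ i → Approx K (x i) (y i) (a i)) →
                  Approx (j ℕ.+ k) (flfold acc δ x) (accy + Σ y) (acca + Σ a)
  flfold-approx {ℕ.zero} j K K≤j {accy = accy} {acca} δ x y a ∣δ∣≤ε acc≈ x≈y =
    approx-cong (sym (ℕₚ.+-identityʳ j)) (sym (ℚₚ.+-identityʳ accy)) (sym (ℚₚ.+-identityʳ acca)) acc≈
  flfold-approx {ℕ.suc k} j K K≤j {accy = accy} {acca} δ x y a ∣δ∣≤ε acc≈ x≈y =
    approx-cong (sym (ℕₚ.+-suc j k)) (ℚₚ.+-assoc accy (y zero) (Σ (y ∘ suc))) (ℚₚ.+-assoc acca (a zero) (Σ (a ∘ suc)))
      (flfold-approx (ℕ.suc j) K (ℕₚ.m≤n⇒m≤1+n K≤j) (δ ∘ suc) (x ∘ suc) (y ∘ suc) (a ∘ suc) (∣δ∣≤ε ∘ suc)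
        (approx-round (∣δ∣≤ε zero) (approx-+ acc≈ (approx-weaken K≤j (x≈y zero)))) (x≈y ∘ suc))

  flsum-approx : ∀ {k} K (δ x y a : Fin (ℕ.suc k) → ℚ) → (∀ i → ∣ δ i ∣ ≤ ε) →
                 (∀ i → Approx K (x i) (y i) (a i)) → Approx (K ℕ.+ k) (flsum δ x) (Σ y) (Σ a)
  flsum-approx K δ x y a ∣δ∣≤ε x≈y =
    flfold-approx K K ℕₚ.≤-refl (δ ∘ suc) (x ∘ suc) (y ∘ suc) (a ∘ suc) (∣δ∣≤ε ∘ suc) (x≈y zero) (x≈y ∘ suc)

  flLinComb-approx : ∀ {a b} (δ₁ δ₂ : Fin (ℕ.suc a) → Fin (ℕ.suc b) → ℚ) (δ₃ : Fin (ℕ.suc a) → ℚ) →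
    (∀ k l → ∣ δ₁ k l ∣ ≤ ε) → (∀ k l → ∣ δ₂ k l ∣ ≤ ε) → (∀ k → ∣ δ₃ k ∣ ≤ ε) →
    (x y : Fin (ℕ.suc a) → Fin (ℕ.suc b) → ℚ) →
    Approx (ℕ.suc b ℕ.+ a)
      (flsum δ₃ λ k → flsum (δ₂ k) λ l → (x k l * y k l) * (1ℚ + δ₁ k l))
      (Σ₂ λ k l → x k l * y k l)
      (Σ₂ λ k l → ∣ x k l ∣ * ∣ y k l ∣)
  flLinComb-approx {b = b} δ₁ δ₂ δ₃ ∣δ₁∣≤ε ∣δ₂∣≤ε ∣δ₃∣≤ε x y =
    flsum-approx (ℕ.suc b) δ₃ (λ k → flsum (δ₂ k) λ l → (x k l * y k l) * (1ℚ + δ₁ k l))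
      (λ k → Σ λ l → x k l * y k l) (λ k → Σ λ l → ∣ x k l ∣ * ∣ y k l ∣) ∣δ₃∣≤ε λ k →
      flsum-approx 1 (δ₂ k) (λ l → (x k l * y k l) * (1ℚ + δ₁ k l))
        (λ l → x k l * y k l) (λ l → ∣ x k l ∣ * ∣ y k l ∣) (∣δ₂∣≤ε k) λ l →
        approx-round (∣δ₁∣≤ε k l) (approx-* (approx-exact 0 {x k l} ≤-refl) (approx-exact 0 {y k l} ≤-refl))

  flEval-approx : ∀ {n′ m′ R′} (δ : Op (ℕ.suc n′) (ℕ.suc m′) (ℕ.suc R′) → ℚ) → (∀ o → ∣ δ o ∣ ≤ ε) →
    (û v̂ ŵ : Tensor (ℕ.suc n′) (ℕ.suc R′)) (A B : BlockMat (ℕ.suc n′) (ℕ.suc m′)) → ∀ i j p q →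
    Approx (4 ℕ.* ℕ.suc n′ ℕ.+ ℕ.suc m′ ℕ.+ ℕ.suc R′ ∸ 2)
      (flEval δ û v̂ ŵ A B i j p q) (exactEval û v̂ ŵ A B i j p q)
      (exactEval ∣ û ∣ᵀ ∣ v̂ ∣ᵀ ∣ ŵ ∣ᵀ ∣ A ∣ᴮ ∣ B ∣ᴮ i j p q)
  flEval-approx {n′} {m′} {R′} δ ∣δ∣≤ε û v̂ ŵ A B i j p q =
    approx-cong roundings refl refl
      (flsum-approx (ℕ.suc (ℕ.suc (combination ℕ.+ combination) ℕ.+ m′)) (λ r → δ (rAdd i j p q r))
        (λ r → (ŵ i j r * flProduct r) * (1ℚ + δ (wMul i j r p q)))
        (λ r → ŵ i j r * (linComb û A r · linComb v̂ B r) p q)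
        (λ r → ∣ ŵ i j r ∣ * (linComb ∣ û ∣ᵀ ∣ A ∣ᴮ r · linComb ∣ v̂ ∣ᵀ ∣ B ∣ᴮ r) p q)
        (λ _ → ∣δ∣≤ε _) λ r →
        approx-round (∣δ∣≤ε _) (approx-scale (ŵ i j r)
          (flsum-approx (ℕ.suc (combination ℕ.+ combination)) (λ t → δ (pAdd r p q t))
            (λ t → (flA r p t * flB r t q) * (1ℚ + δ (pMul r p q t)))
            (λ t → linComb û A r p t * linComb v̂ B r t q)
            (λ t → linComb ∣ û ∣ᵀ ∣ A ∣ᴮ r p t * linComb ∣ v̂ ∣ᵀ ∣ B ∣ᴮ r t q)
            (λ _ → ∣δ∣≤ε _) λ t →
            approx-round (∣δ∣≤ε _) (approx-* (flA≈ r p t) (flB≈ r t q)))))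
    where
    n m R : ℕ
    n = ℕ.suc n′
    m = ℕ.suc m′
    R = ℕ.suc R′
    combination : ℕ
    combination = ℕ.suc n′ ℕ.+ n′
    flA flB : Fin R → Matrix m m
    flA r a b = flsum (λ k → δ (aOut r a b k)) λ k → flsum (λ l → δ (aIn r a b k l)) λ l →
                  (û k l r * A k l a b) * (1ℚ + δ (aMul r a b k l))
    flB r a b = flsum (λ k → δ (bOut r a b k)) λ k → flsum (λ l → δ (bIn r a b k l)) λ l →
                  (v̂ k l r * B k l a b) * (1ℚ + δ (bMul r a b k l))
    flProduct : Fin R → ℚ
    flProduct r = flsum (λ t → δ (pAdd r p q t)) λ t → (flA r p t * flB r t q) * (1ℚ + δ (pMul r p q t))
    flA≈ : ∀ r a b → Approx combination (flA r a b) (linComb û A r a b) (linComb ∣ û ∣ᵀ ∣ A ∣ᴮ r a b)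
    flA≈ r a b = flLinComb-approx (λ k l → δ (aMul r a b k l)) (λ k l → δ (aIn r a b k l)) (λ k → δ (aOut r a b k))
                   (λ _ _ → ∣δ∣≤ε _) (λ _ _ → ∣δ∣≤ε _) (λ _ → ∣δ∣≤ε _)
                   (λ k l → û k l r) (λ k l → A k l a b)
    flB≈ : ∀ r a b → Approx combination (flB r a b) (linComb v̂ B r a b) (linComb ∣ v̂ ∣ᵀ ∣ B ∣ᴮ r a b)
    flB≈ r a b = flLinComb-approx (λ k l → δ (bMul r a b k l)) (λ k l → δ (bIn r a b k l)) (λ k → δ (bOut r a b k))
                   (λ _ _ → ∣δ∣≤ε _) (λ _ _ → ∣δ∣≤ε _) (λ _ → ∣δ∣≤ε _)
                   (λ k l → v̂ k l r) (λ k l → B k l a b)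
    roundings : ℕ.suc (ℕ.suc (combination ℕ.+ combination) ℕ.+ m′) ℕ.+ R′ ≡ 4 ℕ.* n ℕ.+ m ℕ.+ R ∸ 2
    roundings = trans (sym (ℕₚ.m+n∸n≡m _ 2)) (cong (_∸ 2) (count n′ m′ R′))
      where
      count : ∀ a b c → ℕ.suc (ℕ.suc (ℕ.suc a ℕ.+ a ℕ.+ (ℕ.suc a ℕ.+ a)) ℕ.+ b) ℕ.+ c ℕ.+ 2
                      ≡ 4 ℕ.* ℕ.suc a ℕ.+ ℕ.suc b ℕ.+ ℕ.suc c
      count = ℕ-Ring.solve-∀

signℚ-sq : ∀ s → signℚ s * signℚ s ≡ 1ℚ
signℚ-sq Sign.+ = refl
signℚ-sq Sign.- = refl

signed-sq : ∀ x s t → (x * signℚ s * signℚ t) * (x * signℚ s * signℚ t) ≡ x * x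
signed-sq x s t = begin
  (x * signℚ s * signℚ t) * (x * signℚ s * signℚ t)
    ≡⟨ solve 3 (λ x σ τ → (x :* σ :* τ) :* (x :* σ :* τ) := (x :* x) :* (σ :* σ) :* (τ :* τ))
         refl x (signℚ s) (signℚ t) ⟩
  (x * x) * (signℚ s * signℚ s) * (signℚ t * signℚ t)
    ≡⟨ cong₂ (λ σ² τ² → (x * x) * σ² * τ²) (signℚ-sq s) (signℚ-sq t) ⟩
  (x * x) * 1ℚ * 1ℚ
    ≡⟨ solve 1 (λ y → y :* con 1ℚ :* con 1ℚ := y) refl (x * x) ⟩
  x * x ∎
  where open ≡-Reasoning

sqNorm-signed-permute : ∀ {a b} (π : Permutation′ a) (σ : Permutation′ b) (s : Fin a → Sign) (t : Fin b → Sign)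
  (M : Matrix a b) → sqNorm (λ i j → M (π ⟨$⟩ʳ i) (σ ⟨$⟩ʳ j) * signℚ (s i) * signℚ (t j)) ≡ sqNorm M
sqNorm-signed-permute π σ s t M =
  trans (Σ₂-cong λ i j → signed-sq (M (π ⟨$⟩ʳ i) (σ ⟨$⟩ʳ j)) (s i) (t j)) (Σ₂-permute π σ λ i j → M i j * M i j)

module _ {n R : ℕ} (ρ : Randomness n) (U V W : Tensor n R) (c : ℚ) where
  open Randomness ρ
  open Hat ρ U V W c

  Σ-sliceSq-hat : Σ (λ r → sliceSq û r * sliceSq v̂ r * sliceSq ŵ r)
                ≡ (c * c) * Σ (λ r → sliceSq U r * sliceSq V r * sliceSq W r)
  Σ-sliceSq-hat =
    trans (Σ-cong λ r → trans (cong₂ _*_ (cong₂ _*_ (û-sq r) (v̂-sq r)) (ŵ-sq r))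
                              (solve 4 (λ c u v w → u :* v :* (c :* w) := c :* (u :* v :* w)) refl
                                 (c * c) (sliceSq U r) (sliceSq V r) (sliceSq W r)))
          (Σ-*ˡ (c * c) λ r → sliceSq U r * sliceSq V r * sliceSq W r)
    where
    û-sq : ∀ r → sliceSq û r ≡ sliceSq U r
    û-sq r = sqNorm-signed-permute π₁ π₂ s₁ s₂ λ k l → U k l r
    v̂-sq : ∀ r → sliceSq v̂ r ≡ sliceSq V r
    v̂-sq r = sqNorm-signed-permute π₂ π₃ s₂ s₃ λ k l → V k l r
    ŵ-sq : ∀ r → sliceSq ŵ r ≡ (c * c) * sliceSq W r
    ŵ-sq r = trans (Σ₂-cong λ i j → scaled (signℚ (s₁ i)) (signℚ (s₃ j)) (W (π₁ ⟨$⟩ʳ i) (π₃ ⟨$⟩ʳ j) r))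
               (trans (Σ₂-*ˡ (c * c) λ i j → W̃ i j * W̃ i j)
                      (cong (c * c *_) (sqNorm-signed-permute π₁ π₃ s₁ s₃ λ i j → W i j r)))
      where
      W̃ : Matrix n n
      W̃ i j = W (π₁ ⟨$⟩ʳ i) (π₃ ⟨$⟩ʳ j) r * signℚ (s₁ i) * signℚ (s₃ j)
      scaled : ∀ σ τ w → (c * σ * τ * w) * (c * σ * τ * w) ≡ (c * c) * ((w * σ * τ) * (w * σ * τ))
      scaled σ τ w = solve 4 (λ σ τ w c → (c :* σ :* τ :* w) :* (c :* σ :* τ :* w)
                                         := (c :* c) :* ((w :* σ :* τ) :* (w :* σ :* τ)))
                       refl σ τ w c

proposition7 : (n m R : ℕ) .{{_ : NonZero n}} .{{_ : NonZero m}} .{{_ : NonZero R}} →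
    (U V W : Tensor n R) → (ε : ℚ) →
    (pos : 0ℚ < 1ℚ - kappa n U V W) →
    0ℚ ≤ ε →
    ℕtoℚ (4 Data.Nat.* n Data.Nat.+ m Data.Nat.+ R ∸ 2) * ε ≤ + 1 / 100 →
    (ρ : Randomness n) → (δ : Op n m R → ℚ) → (∀ o → ∣ δ o ∣ ≤ ε) →
    (A B : BlockMat n m) →
    let c = inv (1ℚ - kappa n U V W) pos
        open Hat ρ U V W c
        K = + 101 / 100 * ℕtoℚ (4 Data.Nat.* n Data.Nat.+ m Data.Nat.+ R ∸ 2)
        S = Σ λ r → sliceSq U r * sliceSq V r * sliceSq W r
    in frobSq (flEval δ û v̂ ŵ A B −ᴮ exactEval û v̂ ŵ A B)
         ≤ (K * K) * ℕtoℚ R * (ε * ε) * (c * c) * frobSq A * frobSq B * S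
proposition7 n@(ℕ.suc _) m@(ℕ.suc _) R@(ℕ.suc _) U V W ε pos 0≤ε Nε≤1/100 ρ δ ∣δ∣≤ε A B = begin
  frobSq (flEval δ û v̂ ŵ A B −ᴮ exactEval û v̂ ŵ A B)
    ≤⟨ frobSq-≤-entrywise (γ N) (λ i j p q → Approx.error (flEval-approx δ ∣δ∣≤ε û v̂ ŵ A B i j p q)) ⟩
  (γ N * γ N) * frobSq (exactEval ∣ û ∣ᵀ ∣ v̂ ∣ᵀ ∣ ŵ ∣ᵀ ∣ A ∣ᴮ ∣ B ∣ᴮ)
    ≤⟨ *-mono-≤-nonNeg (0≤p*p (γ N)) (0≤frobSq (exactEval ∣ û ∣ᵀ ∣ v̂ ∣ᵀ ∣ ŵ ∣ᵀ ∣ A ∣ᴮ ∣ B ∣ᴮ))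
                       (*-mono-≤-nonNeg (0≤γ N) (0≤γ N) γN≤Kε γN≤Kε)
                       (frobSq-∣exactEval∣-≤ û v̂ ŵ A B) ⟩
  (K * ε) * (K * ε) * (ℕtoℚ R * Σ (λ r → sliceSq û r * sliceSq v̂ r * sliceSq ŵ r) * (frobSq A * frobSq B))
    ≡⟨ cong (λ Ŝ → (K * ε) * (K * ε) * (ℕtoℚ R * Ŝ * (frobSq A * frobSq B))) (Σ-sliceSq-hat ρ U V W c) ⟩
  (K * ε) * (K * ε) * (ℕtoℚ R * ((c * c) * S) * (frobSq A * frobSq B))
    ≡⟨ solve 7 (λ K e r c a b s → (K :* e) :* (K :* e) :* (r :* (c :* s) :* (a :* b))
                                  := (K :* K) :* r :* (e :* e) :* c :* a :* b :* s)
               refl K ε (ℕtoℚ R) (c * c) (frobSq A) (frobSq B) S ⟩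
  (K * K) * ℕtoℚ R * (ε * ε) * (c * c) * frobSq A * frobSq B * S ∎
  where
  open ℚₚ.≤-Reasoning
  open Rounding ε 0≤ε
  c : ℚ
  c = inv (1ℚ - kappa n U V W) pos
  open Hat ρ U V W c
  N : ℕ
  N = 4 ℕ.* n ℕ.+ m ℕ.+ R ∸ 2
  K S : ℚ
  K = + 101 / 100 * ℕtoℚ N
  S = Σ λ r → sliceSq U r * sliceSq V r * sliceSq W r
  γN≤Kε : γ N ≤ K * ε
  γN≤Kε = γ-≤ N Nε≤1/100
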